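{- Let $I_1,I_2$ be operad ideals of $\mathbb{K}\langle \mathbf{Mag}\rangle$ and $\mathcal{O}_1=\mathbb{K}\langle \mathbf{Mag}\rangle/_{I_1}$, $\mathcal{O}_2=\mathbb{K}\langle \mathbf{Mag}\rangle/_{I_2}$. Then $\mathcal{O}_2\preceq_{\mathrm{i}}\mathcal{O}_1$ if and only if $I_1\subseteq I_2$.
   Context: $\mathbb{K}$ is a field of characteristic zero. Operads are nonsymmetric. $\mathbf{Mag}$ is the free (set-theoretic) operad on one binary generator $\star$: $\mathbf{Mag}(n)$ is the set of binary trees with $n$ leaves, partial composition $\mathfrak{t}\circ_i\mathfrak{s}$ grafts the root of $\mathfrak{s}$ onto the $i$-th leaf of $\mathfrak{t}$. $\mathbb{K}\langle \mathbf{Mag}\rangle$ is the linear operad with $\mathbb{K}\langle \mathbf{Mag}\rangle(n)$ having basis $\mathbf{Mag}(n)$, compositions extended bilinearly. An operad ideal $I$ is a family of subspaces $I(n)\subseteq\mathbb{K}\langle \mathbf{Mag}\rangle(n)$ with $x\circ_i y\in I$ whenever $x\in I$ or $y\in I$; $[x]_I$ is the class of $x$ in the quotient. We write $\mathcal{O}_2\preceq_{\mathrm{i}}\mathcal{O}_1$ when there exists a nonzero morphism of linear operads from $\mathcal{O}_1$ to $\mathcal{O}_2$ (arity-preserving linear maps commuting with partial compositions, nonzero on the binary generator $[\star]_{I_1}$). -}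

module Defs where

open import Level using (Level; _⊔_) renaming (suc to lsuc)
open import Algebra.Bundles using (CommutativeRing)
open import Data.Nat using (ℕ; zero; suc) renaming (_+_ to _+ℕ_)
open import Data.Nat.Properties using (suc-injective; +-suc; +-assoc; +-comm)
open import Data.Fin using (Fin; splitAt; cast)
import Data.Fin as Fin
open import Data.Sum using (inj₁; inj₂)
open import Data.Product using (Σ; ∃; _,_; proj₁; proj₂; _×_)
open import Data.List using (List; []; _∷_; _++_; map; concatMap)
open import Relation.Nullary using (¬_; Dec; yes; no)
open import Relation.Binary.PropositionalEquality using (_≡_; refl; sym; trans; cong; cong₂)

record Field (c ℓ : Level) : Set (lsuc (c ⊔ ℓ)) where
  field
    commutativeRing : CommutativeRing c ℓ
  open CommutativeRing commutativeRing public
  field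
    0≉1     : ¬ (0# ≈ 1#)
    inverse : ∀ x → ¬ (x ≈ 0#) → ∃ λ y → x * y ≈ 1#

module _ {c ℓ} (F : Field c ℓ) where
  open Field F
  natF : ℕ → Carrier
  natF zero    = 0#
  natF (suc n) = 1# + natF n

  CharZero : Set ℓ
  CharZero = ∀ n → ¬ (natF (suc n) ≈ 0#)

data Tree : Set where
  leaf : Tree
  node : Tree → Tree → Tree

leaves : Tree → ℕ
leaves leaf       = 1
leaves (node l r) = leaves l +ℕ leaves r

_≟T_ : (s t : Tree) → Dec (s ≡ t)
leaf ≟T leaf = yes refl
leaf ≟T node _ _ = no λ ()
node _ _ ≟T leaf = no λ ()
node l r ≟T node l' r' with l ≟T l' | r ≟T r'
... | yes refl | yes refl = yes refl
... | no ne | _ = no λ { refl → ne refl }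
... | yes _ | no ne = no λ { refl → ne refl }

-- grafting the root of s onto the i-th leaf of t (leaves numbered from 0, left to right)
graft : (t : Tree) → Fin (leaves t) → Tree → Tree
graft leaf Fin.zero s = s
graft (node l r) i s with splitAt (leaves l) i
... | inj₁ j = node (graft l j s) r
... | inj₂ j = node l (graft r j s)

leaves-graft : ∀ t i s → suc (leaves (graft t i s)) ≡ leaves t +ℕ leaves s
leaves-graft leaf Fin.zero s = refl
leaves-graft (node l r) i s with splitAt (leaves l) i
... | inj₁ j = trans (cong (_+ℕ leaves r) (leaves-graft l j s))
               (trans (+-assoc (leaves l) (leaves s) (leaves r))
               (trans (cong (leaves l +ℕ_) (+-comm (leaves s) (leaves r)))
                      (sym (+-assoc (leaves l) (leaves r) (leaves s)))))
... | inj₂ j = trans (sym (+-suc (leaves l) (leaves (graft r j s))))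
               (trans (cong (leaves l +ℕ_) (leaves-graft r j s))
                      (sym (+-assoc (leaves l) (leaves r) (leaves s))))

Mag : ℕ → Set
Mag n = Σ Tree λ t → leaves t ≡ n

_∘ᴹ⟨_⟩_ : ∀ {k m} → Mag (suc k) → Fin (suc k) → Mag m → Mag (k +ℕ m)
_∘ᴹ⟨_⟩_ {k} {m} (t , p) i (s , q) =
  graft t (cast (sym p) i) s ,
  suc-injective (trans (leaves-graft t (cast (sym p) i) s) (cong₂ _+ℕ_ p q))

module LinearMag {c ℓ} (F : Field c ℓ) where
  open Field F using (Carrier; _≈_; _+_; _*_; -_; 0#; 1#)

  -- an element of K⟨Mag⟩(n), as a finite formal linear combination of trees
  Sum : ℕ → Set c
  Sum n = List (Carrier × Mag n)

  coeff : ∀ {n} → Sum n → Mag n → Carrier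
  coeff [] t = 0#
  coeff ((a , s) ∷ xs) t with proj₁ s ≟T proj₁ t
  ... | yes _ = a + coeff xs t
  ... | no _  = coeff xs t

  _≋_ : ∀ {n} → Sum n → Sum n → Set ℓ
  x ≋ y = ∀ t → coeff x t ≈ coeff y t

  𝟘 : ∀ {n} → Sum n
  𝟘 = []

  _⊕_ : ∀ {n} → Sum n → Sum n → Sum n
  x ⊕ y = x ++ y

  _·_ : ∀ {n} → Carrier → Sum n → Sum n
  a · x = map (λ p → (a * proj₁ p , proj₂ p)) x

  _⊖_ : ∀ {n} → Sum n → Sum n → Sum n
  x ⊖ y = x ⊕ ((- 1#) · y)

  _∘⟨_⟩_ : ∀ {k m} → Sum (suc k) → Fin (suc k) → Sum m → Sum (k +ℕ m)
  x ∘⟨ i ⟩ y = concatMap (λ p → map (λ q → (proj₁ p * proj₁ q , proj₂ p ∘ᴹ⟨ i ⟩ proj₂ q)) y) x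

  ⋆ : Sum 2
  ⋆ = (1# , (node leaf leaf , refl)) ∷ []

  record Ideal (p : Level) : Set (c ⊔ ℓ ⊔ lsuc p) where
    field
      _∈I        : ∀ {n} → Sum n → Set p
      ∈-resp-≋   : ∀ {n} {x y : Sum n} → x ≋ y → x ∈I → y ∈I
      𝟘∈I        : ∀ {n} → (𝟘 {n}) ∈I
      ⊕-closed   : ∀ {n} {x y : Sum n} → x ∈I → y ∈I → (x ⊕ y) ∈I
      ·-closed   : ∀ {n} (a : Carrier) {x : Sum n} → x ∈I → (a · x) ∈I
      ∘-closedˡ  : ∀ {k m} {x : Sum (suc k)} (i : Fin (suc k)) (y : Sum m) → x ∈I → (x ∘⟨ i ⟩ y) ∈I
      ∘-closedʳ  : ∀ {k m} (x : Sum (suc k)) (i : Fin (suc k)) {y : Sum m} → y ∈I → (x ∘⟨ i ⟩ y) ∈I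

  open Ideal public

  _~[_]_ : ∀ {p n} → Sum n → Ideal p → Sum n → Set p
  x ~[ I ] y = _∈I I (x ⊖ y)

  _⊆_ : ∀ {p₁ p₂} → Ideal p₁ → Ideal p₂ → Set (c ⊔ p₁ ⊔ p₂)
  I₁ ⊆ I₂ = ∀ {n} (x : Sum n) → _∈I I₁ x → _∈I I₂ x

  -- morphisms of linear operads K⟨Mag⟩/I₁ → K⟨Mag⟩/I₂, given on representatives,
  -- nonzero on the binary generator
  record Morphism {p₁ p₂} (I₁ : Ideal p₁) (I₂ : Ideal p₂) : Set (c ⊔ p₁ ⊔ p₂) where
    field
      φ        : ∀ {n} → Sum n → Sum n
      φ-cong   : ∀ {n} {x y : Sum n} → x ~[ I₁ ] y → φ x ~[ I₂ ] φ y
      φ-⊕      : ∀ {n} (x y : Sum n) → φ (x ⊕ y) ~[ I₂ ] (φ x ⊕ φ y)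
      φ-·      : ∀ {n} (a : Carrier) (x : Sum n) → φ (a · x) ~[ I₂ ] (a · φ x)
      φ-∘      : ∀ {k m} (x : Sum (suc k)) (i : Fin (suc k)) (y : Sum m) →
                 φ (x ∘⟨ i ⟩ y) ~[ I₂ ] (φ x ∘⟨ i ⟩ φ y)
      φ-nonzero : ¬ (φ ⋆ ~[ I₂ ] 𝟘)

  -- O₂ ≼ᵢ O₁ (with Oⱼ = K⟨Mag⟩/Iⱼ): a nonzero morphism O₁ → O₂ exists
  _≼ᵢ_ : ∀ {p₁ p₂} → Ideal p₂ → Ideal p₁ → Set (c ⊔ p₁ ⊔ p₂)
  I₂ ≼ᵢ I₁ = Morphism I₁ I₂

-- A nonzero morphism φ : K⟨Mag⟩/I₁ → K⟨Mag⟩/I₂ is pinned down by the two arities that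
-- contain a single tree: φ(⋆) = λ⋆ and φ(1) = μ1 for the one-leaf tree 1, where λ ≠ 0
-- because φ is nonzero and μ ≠ 0 because ⋆ = ⋆ ∘₀ 1. Every tree t is an iterated composite
-- of copies of ⋆, so φ(t) = w(t) t with λ w(t) = (λμ)^(number of leaves of t). Hence in
-- arity n, λ φ(x) = (λμ)^n x for every x; if x ∈ I₁ then φ(x) = 0, so (λμ)^n x ∈ I₂ and
-- x ∈ I₂. Conversely, if I₁ ⊆ I₂ the identity on representatives is a morphism, nonzero
-- because ⋆ ∉ I₂.
module Submission where

open import Defs
open import Level using (Level; _⊔_)
open import Relation.Nullary using (¬_; yes; no)
open import Function.Bundles using (_⇔_; mk⇔)

open import Algebra.Bundles using (CommutativeRing)
open import Data.Empty using (⊥-elim)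
open import Data.Fin using (Fin; splitAt; toℕ; fromℕ) renaming (zero to fzero; suc to fsuc)
open import Data.Fin.Properties using (toℕ-cast; toℕ-fromℕ)
open import Data.List using ([]; _∷_; _++_; map)
open import Data.List.Properties using (++-assoc; ++-identityʳ; map-++)
open import Data.Nat using (ℕ; zero; suc) renaming (_+_ to _+ℕ_)
open import Data.Nat.Properties using (suc-injective; ≡-irrelevant; m+1+n≢0)
open import Data.Product using (_,_; proj₁; proj₂; _×_)
open import Data.Sum using (inj₂)
open import Relation.Binary.Bundles using (Setoid)
open import Relation.Binary.PropositionalEquality as ≡ using (_≡_; _≢_)

leaves≢0 : ∀ t → leaves t ≢ 0
leaves≢0 leaf ()
leaves≢0 (node l r) e with leaves l in el
... | zero = leaves≢0 l el
leaves≢0 (node l r) () | suc _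

leaves≡1⇒leaf : ∀ t → leaves t ≡ 1 → t ≡ leaf
leaves≡1⇒leaf leaf _ = ≡.refl
leaves≡1⇒leaf (node l r) e with leaves l in el | leaves r in er
... | zero  | _    = ⊥-elim (leaves≢0 l el)
... | suc _ | zero = ⊥-elim (leaves≢0 r er)
leaves≡1⇒leaf (node l r) () | suc zero    | suc _
leaves≡1⇒leaf (node l r) () | suc (suc _) | suc _

leaves≡2⇒cherry : ∀ t → leaves t ≡ 2 → t ≡ node leaf leaf
leaves≡2⇒cherry (node l r) e with leaves l in el | leaves r in er
... | zero     | _        = ⊥-elim (leaves≢0 l el)
... | suc _    | zero     = ⊥-elim (leaves≢0 r er)
... | suc zero | suc zero = ≡.cong₂ node (leaves≡1⇒leaf l el) (leaves≡1⇒leaf r er)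
leaves≡2⇒cherry (node l r) () | suc zero | suc (suc _)
leaves≡2⇒cherry (node l r) e  | suc (suc a) | suc b =
  ⊥-elim (m+1+n≢0 a (suc-injective (suc-injective e)))

splitAt-last : ∀ m (i : Fin (m +ℕ 1)) → toℕ i ≡ m → splitAt m i ≡ inj₂ fzero
splitAt-last zero    fzero    _ = ≡.refl
splitAt-last (suc m) (fsuc i) e rewrite splitAt-last m i (suc-injective e) = ≡.refl

graft-last : ∀ l r (i : Fin (leaves l +ℕ 1)) → toℕ i ≡ leaves l →
             graft (node l leaf) i r ≡ node l r
graft-last l r i e rewrite splitAt-last (leaves l) i e = ≡.refl

Mag-≡ : ∀ {n} {s t : Mag n} → proj₁ s ≡ proj₁ t → s ≡ t
Mag-≡ {s = t , p} {.t , q} ≡.refl = ≡.cong (t ,_) (≡-irrelevant p q)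

leafᴹ : Mag 1
leafᴹ = leaf , ≡.refl

⋆ᴹ : Mag 2
⋆ᴹ = node leaf leaf , ≡.refl

Mag1-unique : ∀ (s : Mag 1) → s ≡ leafᴹ
Mag1-unique (t , p) = Mag-≡ (leaves≡1⇒leaf t p)

Mag2-unique : ∀ (s : Mag 2) → s ≡ ⋆ᴹ
Mag2-unique (t , p) = Mag-≡ (leaves≡2⇒cherry t p)

cherry-graft : ∀ l r →
  proj₁ ((⋆ᴹ ∘ᴹ⟨ fzero ⟩ (l , ≡.refl)) ∘ᴹ⟨ fromℕ (leaves l) ⟩ (r , ≡.refl)) ≡ node l r
cherry-graft l r =
  graft-last l r _ (≡.trans (toℕ-cast _ (fromℕ (leaves l))) (toℕ-fromℕ (leaves l)))

module CommutativeRingLemmas {c ℓ} (R : CommutativeRing c ℓ) where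
  open CommutativeRing R
  open import Relation.Binary.Reasoning.Setoid setoid
  open import Algebra.Properties.Ring ring using (-‿+-comm)
  open import Algebra.Properties.CommutativeSemigroup +-commutativeSemigroup
    using () renaming (interchange to +-interchange)

  +-scaled : ∀ {a u v U V} → u ≈ a * v → U ≈ a * V → u + U ≈ a * (v + V)
  +-scaled {a} {v = v} {V = V} u≈av U≈aV = trans (+-cong u≈av U≈aV) (sym (distribˡ a v V))

  [x-y]+[y-z]≈x-z : ∀ x y z → (x - y) + (y - z) ≈ x - z
  [x-y]+[y-z]≈x-z x y z = begin
    (x - y) + (y - z)     ≈⟨ +-assoc x (- y) (y - z) ⟩
    x + (- y + (y - z))   ≈⟨ +-congˡ (+-assoc (- y) y (- z)) ⟨
    x + ((- y + y) - z)   ≈⟨ +-congˡ (+-congʳ (-‿inverseˡ y)) ⟩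
    x + (0# - z)          ≈⟨ +-congˡ (+-identityˡ (- z)) ⟩
    x - z                 ∎

  [x-x']+[y-y']≈[x+y]-[x'+y'] : ∀ x x' y y' → (x - x') + (y - y') ≈ (x + y) - (x' + y')
  [x-x']+[y-y']≈[x+y]-[x'+y'] x x' y y' =
    trans (+-interchange x (- x') y (- y')) (+-congˡ (-‿+-comm x' y'))

module FieldLemmas {c ℓ} (F : Field c ℓ) where
  open Field F
  open import Relation.Binary.Reasoning.Setoid setoid
  open import Algebra.Properties.Semiring.Exp semiring using (_^_)

  *-nonzero : ∀ {a b} → ¬ a ≈ 0# → ¬ b ≈ 0# → ¬ a * b ≈ 0#
  *-nonzero {a} {b} a≉0 b≉0 ab≈0 with inverse a a≉0
  ... | a⁻¹ , aa⁻¹≈1 = b≉0 (begin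
    b               ≈⟨ *-identityˡ b ⟨
    1# * b          ≈⟨ *-congʳ (trans (sym aa⁻¹≈1) (*-comm a a⁻¹)) ⟩
    (a⁻¹ * a) * b   ≈⟨ *-assoc a⁻¹ a b ⟩
    a⁻¹ * (a * b)   ≈⟨ *-congˡ ab≈0 ⟩
    a⁻¹ * 0#        ≈⟨ zeroʳ a⁻¹ ⟩
    0#              ∎)

  ^-nonzero : ∀ {a} → ¬ a ≈ 0# → ∀ n → ¬ a ^ n ≈ 0#
  ^-nonzero a≉0 zero    1≈0 = 0≉1 (sym 1≈0)
  ^-nonzero a≉0 (suc n)     = *-nonzero a≉0 (^-nonzero a≉0 n)

module Coefficients {c ℓ} (F : Field c ℓ) where
  open Field F
  open LinearMag F
  open CommutativeRingLemmas commutativeRing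
  open import Relation.Binary.Reasoning.Setoid setoid
  open import Algebra.Properties.Ring ring using (-1*x≈-x)
  open import Algebra.Properties.CommutativeSemigroup *-commutativeSemigroup
    using () renaming (x∙yz≈y∙xz to *-left-comm)

  term : ∀ {n} → Carrier → Mag n → Sum n
  term a s = (a , s) ∷ []

  ⟦_⟧ : (t : Tree) → Sum (leaves t)
  ⟦ t ⟧ = term 1# (t , ≡.refl)

  coeff-⊕ : ∀ {n} (x y : Sum n) t → coeff (x ⊕ y) t ≈ coeff x t + coeff y t
  coeff-⊕ []            y t = sym (+-identityˡ _)
  coeff-⊕ ((a , s) ∷ x) y t with proj₁ s ≟T proj₁ t
  ... | yes _ = trans (+-congˡ (coeff-⊕ x y t)) (sym (+-assoc a _ _))
  ... | no _  = coeff-⊕ x y t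

  coeff-· : ∀ {n} a (x : Sum n) t → coeff (a · x) t ≈ a * coeff x t
  coeff-· a []            t = sym (zeroʳ a)
  coeff-· a ((b , s) ∷ x) t with proj₁ s ≟T proj₁ t
  ... | yes _ = +-scaled refl (coeff-· a x t)
  ... | no _  = coeff-· a x t

  coeff-⊖ : ∀ {n} (x y : Sum n) t → coeff (x ⊖ y) t ≈ coeff x t - coeff y t
  coeff-⊖ x y t = trans (coeff-⊕ x _ t) (+-congˡ (trans (coeff-· (- 1#) y t) (-1*x≈-x _)))

  ·-⊕ : ∀ {n} a (x y : Sum n) → (a · (x ⊕ y)) ≡ ((a · x) ⊕ (a · y))
  ·-⊕ a = map-++ _

  ·-zero : ∀ {n a} (x : Sum n) → a ≈ 0# → (a · x) ≋ 𝟘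
  ·-zero {a = a} x a≈0 t = trans (coeff-· a x t) (trans (*-congʳ a≈0) (zeroˡ _))

  coeff-⊕-split : ∀ {n} (u u₁ u₂ v v₁ v₂ : Sum n) t →
                  coeff u t ≈ coeff u₁ t + coeff u₂ t → coeff v t ≈ coeff v₁ t + coeff v₂ t →
                  coeff (u ⊕ v) t ≈ coeff (u₁ ⊕ v₁) t + coeff (u₂ ⊕ v₂) t
  coeff-⊕-split u u₁ u₂ v v₁ v₂ t u≈ v≈ = begin
    coeff (u ⊕ v) t                                       ≈⟨ coeff-⊕ u v t ⟩
    coeff u t + coeff v t                                 ≈⟨ +-cong u≈ v≈ ⟩
    (coeff u₁ t + coeff u₂ t) + (coeff v₁ t + coeff v₂ t) ≈⟨ +-interchange _ _ _ _ ⟩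
    (coeff u₁ t + coeff v₁ t) + (coeff u₂ t + coeff v₂ t) ≈⟨ +-cong (coeff-⊕ u₁ v₁ t) (coeff-⊕ u₂ v₂ t) ⟨
    coeff (u₁ ⊕ v₁) t + coeff (u₂ ⊕ v₂) t                 ∎
    where
    open import Algebra.Properties.CommutativeSemigroup +-commutativeSemigroup
      using () renaming (interchange to +-interchange)

  coeff-⊕-scaled : ∀ {n} a (u u' v v' : Sum n) t →
                   coeff u t ≈ a * coeff u' t → coeff v t ≈ a * coeff v' t →
                   coeff (u ⊕ v) t ≈ a * coeff (u' ⊕ v') t
  coeff-⊕-scaled a u u' v v' t u≈ v≈ =
    trans (coeff-⊕ u v t) (trans (+-scaled u≈ v≈) (*-congˡ (sym (coeff-⊕ u' v' t))))

  -- (p ∷ x) ∘⟨ i ⟩ y reduces definitionally to (p ▹⟨ i ⟩ y) ⊕ (x ∘⟨ i ⟩ y).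
  _▹⟨_⟩_ : ∀ {k m} → Carrier × Mag (suc k) → Fin (suc k) → Sum m → Sum (k +ℕ m)
  p ▹⟨ i ⟩ y = map (λ q → (proj₁ p * proj₁ q , proj₂ p ∘ᴹ⟨ i ⟩ proj₂ q)) y

  coeff-▹-⊕ : ∀ {k m} p (i : Fin (suc k)) (y y' : Sum m) t →
              coeff (p ▹⟨ i ⟩ (y ⊕ y')) t ≈ coeff (p ▹⟨ i ⟩ y) t + coeff (p ▹⟨ i ⟩ y') t
  coeff-▹-⊕ p i y y' t =
    trans (reflexive (≡.cong (λ z → coeff z t) (map-++ _ y y')))
          (coeff-⊕ (p ▹⟨ i ⟩ y) (p ▹⟨ i ⟩ y') t)

  coeff-▹-·ʳ : ∀ {k m} p (i : Fin (suc k)) a (y : Sum m) t →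
               coeff (p ▹⟨ i ⟩ (a · y)) t ≈ a * coeff (p ▹⟨ i ⟩ y) t
  coeff-▹-·ʳ p i a []            t = sym (zeroʳ a)
  coeff-▹-·ʳ p i a ((b , s) ∷ y) t with proj₁ (proj₂ p ∘ᴹ⟨ i ⟩ s) ≟T proj₁ t
  ... | yes _ = +-scaled (*-left-comm (proj₁ p) a b) (coeff-▹-·ʳ p i a y t)
  ... | no _  = coeff-▹-·ʳ p i a y t

  coeff-▹-·ˡ : ∀ {k m} a b (s : Mag (suc k)) i (y : Sum m) t →
               coeff ((a * b , s) ▹⟨ i ⟩ y) t ≈ a * coeff ((b , s) ▹⟨ i ⟩ y) t
  coeff-▹-·ˡ a b s i []             t = sym (zeroʳ a)
  coeff-▹-·ˡ a b s i ((d , s') ∷ y) t with proj₁ (s ∘ᴹ⟨ i ⟩ s') ≟T proj₁ t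
  ... | yes _ = +-scaled (*-assoc a b d) (coeff-▹-·ˡ a b s i y t)
  ... | no _  = coeff-▹-·ˡ a b s i y t

  ∘-⊕ˡ : ∀ {k m} (x x' : Sum (suc k)) i (y : Sum m) →
         ((x ⊕ x') ∘⟨ i ⟩ y) ≡ ((x ∘⟨ i ⟩ y) ⊕ (x' ∘⟨ i ⟩ y))
  ∘-⊕ˡ []      x' i y = ≡.refl
  ∘-⊕ˡ (p ∷ x) x' i y =
    ≡.trans (≡.cong (p ▹⟨ i ⟩ y ++_) (∘-⊕ˡ x x' i y)) (≡.sym (++-assoc (p ▹⟨ i ⟩ y) _ _))

  coeff-∘-⊕ˡ : ∀ {k m} (x x' : Sum (suc k)) i (y : Sum m) t →
               coeff ((x ⊕ x') ∘⟨ i ⟩ y) t ≈ coeff (x ∘⟨ i ⟩ y) t + coeff (x' ∘⟨ i ⟩ y) t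
  coeff-∘-⊕ˡ x x' i y t =
    trans (reflexive (≡.cong (λ z → coeff z t) (∘-⊕ˡ x x' i y)))
          (coeff-⊕ (x ∘⟨ i ⟩ y) (x' ∘⟨ i ⟩ y) t)

  coeff-∘-·ˡ : ∀ {k m} a (x : Sum (suc k)) i (y : Sum m) t →
               coeff ((a · x) ∘⟨ i ⟩ y) t ≈ a * coeff (x ∘⟨ i ⟩ y) t
  coeff-∘-·ˡ a []            i y t = sym (zeroʳ a)
  coeff-∘-·ˡ a ((b , s) ∷ x) i y t =
    coeff-⊕-scaled a ((a * b , s) ▹⟨ i ⟩ y) ((b , s) ▹⟨ i ⟩ y) ((a · x) ∘⟨ i ⟩ y) (x ∘⟨ i ⟩ y) t
      (coeff-▹-·ˡ a b s i y t) (coeff-∘-·ˡ a x i y t)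

  coeff-∘-⊕ʳ : ∀ {k m} (x : Sum (suc k)) i (y y' : Sum m) t →
               coeff (x ∘⟨ i ⟩ (y ⊕ y')) t ≈ coeff (x ∘⟨ i ⟩ y) t + coeff (x ∘⟨ i ⟩ y') t
  coeff-∘-⊕ʳ []      i y y' t = sym (+-identityˡ 0#)
  coeff-∘-⊕ʳ (p ∷ x) i y y' t =
    coeff-⊕-split (p ▹⟨ i ⟩ (y ⊕ y')) (p ▹⟨ i ⟩ y) (p ▹⟨ i ⟩ y')
                  (x ∘⟨ i ⟩ (y ⊕ y')) (x ∘⟨ i ⟩ y) (x ∘⟨ i ⟩ y') t
      (coeff-▹-⊕ p i y y' t) (coeff-∘-⊕ʳ x i y y' t)

  coeff-∘-·ʳ : ∀ {k m} (x : Sum (suc k)) i a (y : Sum m) t →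
               coeff (x ∘⟨ i ⟩ (a · y)) t ≈ a * coeff (x ∘⟨ i ⟩ y) t
  coeff-∘-·ʳ []      i a y t = sym (zeroʳ a)
  coeff-∘-·ʳ (p ∷ x) i a y t =
    coeff-⊕-scaled a (p ▹⟨ i ⟩ (a · y)) (p ▹⟨ i ⟩ y) (x ∘⟨ i ⟩ (a · y)) (x ∘⟨ i ⟩ y) t
      (coeff-▹-·ʳ p i a y t) (coeff-∘-·ʳ x i a y t)

  record IsLinear {m n} (f : Sum m → Sum n) : Set (c ⊔ ℓ) where
    field
      coeff-additive    : ∀ x y t → coeff (f (x ⊕ y)) t ≈ coeff (f x) t + coeff (f y) t
      coeff-homogeneous : ∀ a x t → coeff (f (a · x)) t ≈ a * coeff (f x) t

  ·-linear : ∀ {n} a → IsLinear {n} (a ·_)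
  ·-linear a = record
    { coeff-additive    = λ x y t → begin
        coeff (a · (x ⊕ y)) t             ≡⟨ ≡.cong (λ z → coeff z t) (·-⊕ a x y) ⟩
        coeff ((a · x) ⊕ (a · y)) t       ≈⟨ coeff-⊕ (a · x) (a · y) t ⟩
        coeff (a · x) t + coeff (a · y) t ∎
    ; coeff-homogeneous = λ b x t → begin
        coeff (a · (b · x)) t ≈⟨ coeff-· a (b · x) t ⟩
        a * coeff (b · x) t   ≈⟨ *-congˡ (coeff-· b x t) ⟩
        a * (b * coeff x t)   ≈⟨ *-left-comm a b _ ⟩
        b * (a * coeff x t)   ≈⟨ *-congˡ (coeff-· a x t) ⟨
        b * coeff (a · x) t   ∎
    }

  ∘-linearˡ : ∀ {k m} i (y : Sum m) → IsLinear {suc k} (_∘⟨ i ⟩ y)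
  ∘-linearˡ i y = record
    { coeff-additive    = λ x x' t → coeff-∘-⊕ˡ x x' i y t
    ; coeff-homogeneous = λ a x t → coeff-∘-·ˡ a x i y t
    }

  ∘-linearʳ : ∀ {k m} (x : Sum (suc k)) i → IsLinear {m} (x ∘⟨ i ⟩_)
  ∘-linearʳ x i = record
    { coeff-additive    = λ y y' t → coeff-∘-⊕ʳ x i y y' t
    ; coeff-homogeneous = λ a y t → coeff-∘-·ʳ x i a y t
    }

  linear-⊖ : ∀ {m n} {f : Sum m → Sum n} → IsLinear f → ∀ x y → f (x ⊖ y) ≋ (f x ⊖ f y)
  linear-⊖ {f = f} lin x y t = begin
    coeff (f (x ⊖ y)) t                       ≈⟨ coeff-additive x _ t ⟩
    coeff (f x) t + coeff (f ((- 1#) · y)) t  ≈⟨ +-congˡ (coeff-homogeneous (- 1#) y t) ⟩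
    coeff (f x) t + (- 1#) * coeff (f y) t    ≈⟨ +-congˡ (-1*x≈-x _) ⟩
    coeff (f x) t - coeff (f y) t             ≈⟨ coeff-⊖ (f x) (f y) t ⟨
    coeff (f x ⊖ f y) t                       ∎
    where open IsLinear lin

  term-≋ : ∀ {n a b} (s s' : Mag n) → a ≈ b → proj₁ s ≡ proj₁ s' → term a s ≋ term b s'
  term-≋ s s' a≈b s≡s' t with Mag-≡ {s = s} {s'} s≡s'
  ... | ≡.refl with proj₁ s ≟T proj₁ t
  ...   | yes _ = +-congʳ a≈b
  ...   | no _  = refl

  ≋-multiple-of-unique : ∀ {n} (s : Mag n) → (∀ t → t ≡ s) → (x : Sum n) →
                         x ≋ (coeff x s · term 1# s)
  ≋-multiple-of-unique s unique x t rewrite unique t with proj₁ s ≟T proj₁ s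
  ... | yes _  = sym (trans (+-identityʳ _) (*-identityʳ _))
  ... | no s≢s = ⊥-elim (s≢s ≡.refl)

  ⋆≋⋆∘⟦leaf⟧ : ⋆ ≋ (⋆ ∘⟨ fzero ⟩ ⟦ leaf ⟧)
  ⋆≋⋆∘⟦leaf⟧ = term-≋ ⋆ᴹ (⋆ᴹ ∘ᴹ⟨ fzero ⟩ leafᴹ) (sym (*-identityʳ 1#)) ≡.refl

  cherry-composite : ∀ {a b d e} l r → (a * b) * d ≈ e →
    ((term a ⋆ᴹ ∘⟨ fzero ⟩ term b (l , ≡.refl)) ∘⟨ fromℕ (leaves l) ⟩ term d (r , ≡.refl))
      ≋ term e (node l r , ≡.refl)
  cherry-composite l r abd≈e =
    term-≋ ((⋆ᴹ ∘ᴹ⟨ fzero ⟩ (l , ≡.refl)) ∘ᴹ⟨ fromℕ (leaves l) ⟩ (r , ≡.refl)) (node l r , ≡.refl)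
           abd≈e (cherry-graft l r)

module Congruence {c ℓ p} (F : Field c ℓ) (I : LinearMag.Ideal F p) where
  open Field F
  open LinearMag F hiding (_∈I; ∈-resp-≋; 𝟘∈I; ⊕-closed; ·-closed; ∘-closedˡ; ∘-closedʳ)
  open Ideal I
  open Coefficients F
  open CommutativeRingLemmas commutativeRing
  open import Algebra.Properties.Ring ring using (-1*x≈-x; ⁻¹-anti-homo‿-; x≈y⇒x∙y⁻¹≈ε)

  infix 4 _∼_
  record _∼_ {n} (x y : Sum n) : Set p where
    constructor ⟪_⟫
    field difference∈I : x ~[ I ] y
  open _∼_ public

  ≋⇒∼ : ∀ {n} {x y : Sum n} → x ≋ y → x ∼ y
  ≋⇒∼ {x = x} {y} x≋y =
    ⟪ ∈-resp-≋ (λ t → sym (trans (coeff-⊖ x y t) (x≈y⇒x∙y⁻¹≈ε (x≋y t)))) 𝟘∈I ⟫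

  ∼-refl : ∀ {n} {x : Sum n} → x ∼ x
  ∼-refl = ≋⇒∼ (λ _ → refl)

  ∼-sym : ∀ {n} {x y : Sum n} → x ∼ y → y ∼ x
  ∼-sym {x = x} {y} ⟪ h ⟫ = ⟪ ∈-resp-≋ negate (·-closed (- 1#) h) ⟫
    where
    open import Relation.Binary.Reasoning.Setoid setoid
    negate : ((- 1#) · (x ⊖ y)) ≋ (y ⊖ x)
    negate t = begin
      coeff ((- 1#) · (x ⊖ y)) t   ≈⟨ coeff-· (- 1#) (x ⊖ y) t ⟩
      (- 1#) * coeff (x ⊖ y) t     ≈⟨ -1*x≈-x _ ⟩
      - coeff (x ⊖ y) t            ≈⟨ -‿cong (coeff-⊖ x y t) ⟩
      - (coeff x t - coeff y t)    ≈⟨ ⁻¹-anti-homo‿- (coeff x t) (coeff y t) ⟩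
      coeff y t - coeff x t        ≈⟨ coeff-⊖ y x t ⟨
      coeff (y ⊖ x) t              ∎

  ∼-trans : ∀ {n} {x y z : Sum n} → x ∼ y → y ∼ z → x ∼ z
  ∼-trans {x = x} {y} {z} ⟪ h ⟫ ⟪ h' ⟫ = ⟪ ∈-resp-≋ telescope (⊕-closed h h') ⟫
    where
    telescope : ((x ⊖ y) ⊕ (y ⊖ z)) ≋ (x ⊖ z)
    telescope t = trans (coeff-⊕ (x ⊖ y) (y ⊖ z) t)
      (trans (+-cong (coeff-⊖ x y t) (coeff-⊖ y z t))
      (trans ([x-y]+[y-z]≈x-z _ _ _) (sym (coeff-⊖ x z t))))

  ∼-setoid : ℕ → Setoid c p
  ∼-setoid n = record
    { Carrier       = Sum n
    ; _≈_           = _∼_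
    ; isEquivalence = record { refl = ∼-refl ; sym = ∼-sym ; trans = ∼-trans }
    }

  ⊕-cong : ∀ {n} {x x' y y' : Sum n} → x ∼ x' → y ∼ y' → (x ⊕ y) ∼ (x' ⊕ y')
  ⊕-cong {x = x} {x'} {y} {y'} ⟪ h ⟫ ⟪ h' ⟫ = ⟪ ∈-resp-≋ regroup (⊕-closed h h') ⟫
    where
    regroup : ((x ⊖ x') ⊕ (y ⊖ y')) ≋ ((x ⊕ y) ⊖ (x' ⊕ y'))
    regroup t = trans (coeff-⊕ (x ⊖ x') (y ⊖ y') t)
      (trans (+-cong (coeff-⊖ x x' t) (coeff-⊖ y y' t))
      (trans ([x-x']+[y-y']≈[x+y]-[x'+y'] _ _ _ _)
      (sym (trans (coeff-⊖ (x ⊕ y) (x' ⊕ y') t)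
                  (+-cong (coeff-⊕ x y t) (-‿cong (coeff-⊕ x' y' t)))))))

  linear-cong : ∀ {m n} {f : Sum m → Sum n} → IsLinear f → (∀ {x} → x ∈I → f x ∈I) →
                ∀ {x y} → x ∼ y → f x ∼ f y
  linear-cong lin f-closed {x} {y} ⟪ h ⟫ = ⟪ ∈-resp-≋ (linear-⊖ lin x y) (f-closed h) ⟫

  ·-cong : ∀ {n} a {x y : Sum n} → x ∼ y → (a · x) ∼ (a · y)
  ·-cong a = linear-cong (·-linear a) (·-closed a)

  ∘-congˡ : ∀ {k m} {x x' : Sum (suc k)} i (y : Sum m) → x ∼ x' → (x ∘⟨ i ⟩ y) ∼ (x' ∘⟨ i ⟩ y)
  ∘-congˡ i y = linear-cong (∘-linearˡ i y) (∘-closedˡ i y)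

  ∘-congʳ : ∀ {k m} (x : Sum (suc k)) i {y y' : Sum m} → y ∼ y' → (x ∘⟨ i ⟩ y) ∼ (x ∘⟨ i ⟩ y')
  ∘-congʳ x i = linear-cong (∘-linearʳ x i) (∘-closedʳ x i)

  ∈⇒∼𝟘 : ∀ {n} {x : Sum n} → x ∈I → x ∼ 𝟘
  ∈⇒∼𝟘 {x = x} h = ⟪ ≡.subst _∈I (≡.sym (++-identityʳ x)) h ⟫

  ∼𝟘⇒∈ : ∀ {n} {x : Sum n} → x ∼ 𝟘 → x ∈I
  ∼𝟘⇒∈ {x = x} ⟪ h ⟫ = ≡.subst _∈I (++-identityʳ x) h

  ·-reflects-∼𝟘 : ∀ {n a} {x : Sum n} → ¬ a ≈ 0# → (a · x) ∼ 𝟘 → x ∼ 𝟘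
  ·-reflects-∼𝟘 {a = a} {x} a≉0 ax∼𝟘 with inverse a a≉0
  ... | a⁻¹ , aa⁻¹≈1 = ∼-trans (≋⇒∼ undo) (·-cong a⁻¹ ax∼𝟘)
    where
    open import Relation.Binary.Reasoning.Setoid setoid
    undo : x ≋ (a⁻¹ · (a · x))
    undo t = sym (begin
      coeff (a⁻¹ · (a · x)) t   ≈⟨ coeff-· a⁻¹ (a · x) t ⟩
      a⁻¹ * coeff (a · x) t     ≈⟨ *-congˡ (coeff-· a x t) ⟩
      a⁻¹ * (a * coeff x t)     ≈⟨ *-assoc a⁻¹ a _ ⟨
      (a⁻¹ * a) * coeff x t     ≈⟨ *-congʳ (trans (*-comm a⁻¹ a) aa⁻¹≈1) ⟩
      1# * coeff x t            ≈⟨ *-identityˡ _ ⟩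
      coeff x t                 ∎)

module MorphismIsScaling {c ℓ p₁ p₂} (F : Field c ℓ)
  {I₁ : LinearMag.Ideal F p₁} {I₂ : LinearMag.Ideal F p₂} (Φ : LinearMag.Morphism F I₁ I₂) where
  open Field F
  open LinearMag F
  open Coefficients F
  open FieldLemmas F
  open Congruence F I₂
  open Morphism Φ using (φ)
  open import Algebra.Properties.Semiring.Exp semiring using (_^_; ^-homo-*)
  open import Algebra.Properties.CommutativeSemigroup *-commutativeSemigroup
    using () renaming (x∙yz≈y∙xz to *-left-comm)
  module I₁ = Congruence F I₁

  φ-cong : ∀ {n} {x y : Sum n} → x I₁.∼ y → φ x ∼ φ y
  φ-cong I₁.⟪ h ⟫ = ⟪ Morphism.φ-cong Φ h ⟫

  φ-⊕ : ∀ {n} (x y : Sum n) → φ (x ⊕ y) ∼ (φ x ⊕ φ y)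
  φ-⊕ x y = ⟪ Morphism.φ-⊕ Φ x y ⟫

  φ-· : ∀ {n} a (x : Sum n) → φ (a · x) ∼ (a · φ x)
  φ-· a x = ⟪ Morphism.φ-· Φ a x ⟫

  φ-∘ : ∀ {k m} (x : Sum (suc k)) i (y : Sum m) → φ (x ∘⟨ i ⟩ y) ∼ (φ x ∘⟨ i ⟩ φ y)
  φ-∘ x i y = ⟪ Morphism.φ-∘ Φ x i y ⟫

  φ⋆≁𝟘 : ¬ φ ⋆ ∼ 𝟘
  φ⋆≁𝟘 h = Morphism.φ-nonzero Φ (difference∈I h)

  φ𝟘∼𝟘 : ∀ {n} → φ (𝟘 {n}) ∼ 𝟘
  φ𝟘∼𝟘 = ∼-trans (φ-· 0# 𝟘) (≋⇒∼ (·-zero (φ 𝟘) refl))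

  λ₀ μ₀ Λ : Carrier
  λ₀ = coeff (φ ⋆) ⋆ᴹ
  μ₀ = coeff (φ ⟦ leaf ⟧) leafᴹ
  Λ  = λ₀ * μ₀

  φ⋆∼λ₀·⋆ : φ ⋆ ∼ (λ₀ · ⋆)
  φ⋆∼λ₀·⋆ = ≋⇒∼ (≋-multiple-of-unique ⋆ᴹ Mag2-unique (φ ⋆))

  φ⟦leaf⟧∼μ₀·⟦leaf⟧ : φ ⟦ leaf ⟧ ∼ (μ₀ · ⟦ leaf ⟧)
  φ⟦leaf⟧∼μ₀·⟦leaf⟧ = ≋⇒∼ (≋-multiple-of-unique leafᴹ Mag1-unique (φ ⟦ leaf ⟧))

  λ₀≉0 : ¬ λ₀ ≈ 0#
  λ₀≉0 λ₀≈0 = φ⋆≁𝟘 (∼-trans φ⋆∼λ₀·⋆ (≋⇒∼ (·-zero ⋆ λ₀≈0)))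

  μ₀≉0 : ¬ μ₀ ≈ 0#
  μ₀≉0 μ₀≈0 = φ⋆≁𝟘 (begin
    φ ⋆                               ≈⟨ φ-cong (I₁.≋⇒∼ ⋆≋⋆∘⟦leaf⟧) ⟩
    φ (⋆ ∘⟨ fzero ⟩ ⟦ leaf ⟧)         ≈⟨ φ-∘ ⋆ fzero ⟦ leaf ⟧ ⟩
    φ ⋆ ∘⟨ fzero ⟩ φ ⟦ leaf ⟧         ≈⟨ ∘-congʳ (φ ⋆) fzero φ⟦leaf⟧∼μ₀·⟦leaf⟧ ⟩
    φ ⋆ ∘⟨ fzero ⟩ (μ₀ · ⟦ leaf ⟧)    ≈⟨ ≋⇒∼ vanishes ⟩
    𝟘                                 ∎)
    where
    open import Relation.Binary.Reasoning.Setoid (∼-setoid 2)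
    vanishes : (φ ⋆ ∘⟨ fzero ⟩ (μ₀ · ⟦ leaf ⟧)) ≋ 𝟘
    vanishes t =
      trans (coeff-∘-·ʳ (φ ⋆) fzero μ₀ ⟦ leaf ⟧ t) (trans (*-congʳ μ₀≈0) (zeroˡ _))

  -- node l r = (⋆ ∘₀ l) ∘ r, so φ scales it by λ₀ times the factors of l and r.
  weight : Tree → Carrier
  weight leaf       = μ₀
  weight (node l r) = (λ₀ * weight l) * weight r

  φ⟦⟧∼weight· : ∀ t → φ ⟦ t ⟧ ∼ (weight t · ⟦ t ⟧)
  φ⟦⟧∼weight· leaf       = φ⟦leaf⟧∼μ₀·⟦leaf⟧
  φ⟦⟧∼weight· (node l r) = begin
    φ ⟦ node l r ⟧
      ≈⟨ φ-cong (I₁.∼-sym (I₁.≋⇒∼ (cherry-composite l r 1*1*1≈1))) ⟩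
    φ (⋆∘l ∘⟨ j ⟩ ⟦ r ⟧)
      ≈⟨ φ-∘ ⋆∘l j ⟦ r ⟧ ⟩
    φ ⋆∘l ∘⟨ j ⟩ φ ⟦ r ⟧
      ≈⟨ ∘-congˡ j (φ ⟦ r ⟧) (φ-∘ ⋆ fzero ⟦ l ⟧) ⟩
    (φ ⋆ ∘⟨ fzero ⟩ φ ⟦ l ⟧) ∘⟨ j ⟩ φ ⟦ r ⟧
      ≈⟨ ∘-congˡ j (φ ⟦ r ⟧) (∘-congˡ fzero (φ ⟦ l ⟧) φ⋆∼λ₀·⋆) ⟩
    ((λ₀ · ⋆) ∘⟨ fzero ⟩ φ ⟦ l ⟧) ∘⟨ j ⟩ φ ⟦ r ⟧
      ≈⟨ ∘-congˡ j (φ ⟦ r ⟧) (∘-congʳ (λ₀ · ⋆) fzero (φ⟦⟧∼weight· l)) ⟩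
    scaled-⋆∘l ∘⟨ j ⟩ φ ⟦ r ⟧
      ≈⟨ ∘-congʳ scaled-⋆∘l j (φ⟦⟧∼weight· r) ⟩
    scaled-⋆∘l ∘⟨ j ⟩ (weight r · ⟦ r ⟧)
      ≈⟨ ≋⇒∼ (cherry-composite l r unit-factors) ⟩
    weight (node l r) · ⟦ node l r ⟧
      ∎
    where
    open import Relation.Binary.Reasoning.Setoid (∼-setoid _)
    j : Fin (suc (leaves l))
    j = fromℕ (leaves l)
    ⋆∘l scaled-⋆∘l : Sum (suc (leaves l))
    ⋆∘l        = ⋆ ∘⟨ fzero ⟩ ⟦ l ⟧
    scaled-⋆∘l = (λ₀ · ⋆) ∘⟨ fzero ⟩ (weight l · ⟦ l ⟧)
    1*1*1≈1 : (1# * 1#) * 1# ≈ 1#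
    1*1*1≈1 = trans (*-identityʳ _) (*-identityʳ 1#)
    unit-factors : ((λ₀ * 1#) * (weight l * 1#)) * (weight r * 1#) ≈ weight (node l r) * 1#
    unit-factors = trans (*-cong (*-cong (*-identityʳ λ₀) (*-identityʳ _)) (*-identityʳ _))
                         (sym (*-identityʳ _))

  λ₀*weight≈Λ^leaves : ∀ t → λ₀ * weight t ≈ Λ ^ leaves t
  λ₀*weight≈Λ^leaves leaf       = sym (*-identityʳ Λ)
  λ₀*weight≈Λ^leaves (node l r) = begin
    λ₀ * ((λ₀ * weight l) * weight r)  ≈⟨ *-left-comm λ₀ (λ₀ * weight l) (weight r) ⟩
    (λ₀ * weight l) * (λ₀ * weight r)  ≈⟨ *-cong (λ₀*weight≈Λ^leaves l) (λ₀*weight≈Λ^leaves r) ⟩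
    Λ ^ leaves l * Λ ^ leaves r        ≈⟨ ^-homo-* Λ (leaves l) (leaves r) ⟨
    Λ ^ (leaves l +ℕ leaves r)         ∎
    where open import Relation.Binary.Reasoning.Setoid setoid

  λ₀·φ-term∼ : ∀ a t → (λ₀ · φ (term a (t , ≡.refl))) ∼ ((Λ ^ leaves t) · term a (t , ≡.refl))
  λ₀·φ-term∼ a t = begin
    λ₀ · φ (term a (t , ≡.refl))            ≈⟨ ·-cong λ₀ (φ-cong (I₁.≋⇒∼ term≋a·⟦t⟧)) ⟩
    λ₀ · φ (a · ⟦ t ⟧)                      ≈⟨ ·-cong λ₀ (φ-· a ⟦ t ⟧) ⟩
    λ₀ · (a · φ ⟦ t ⟧)                      ≈⟨ ·-cong λ₀ (·-cong a (φ⟦⟧∼weight· t)) ⟩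
    λ₀ · (a · (weight t · ⟦ t ⟧))           ≈⟨ ≋⇒∼ (term-≋ (t , ≡.refl) (t , ≡.refl) factors ≡.refl) ⟩
    (Λ ^ leaves t) · term a (t , ≡.refl)    ∎
    where
    open import Relation.Binary.Reasoning.Setoid (∼-setoid _)
    term≋a·⟦t⟧ : term a (t , ≡.refl) ≋ (a · ⟦ t ⟧)
    term≋a·⟦t⟧ = term-≋ (t , ≡.refl) (t , ≡.refl) (sym (*-identityʳ a)) ≡.refl
    factors : λ₀ * (a * (weight t * 1#)) ≈ Λ ^ leaves t * a
    factors = trans (*-congˡ (*-congˡ (*-identityʳ _)))
              (trans (*-left-comm λ₀ a (weight t))
              (trans (*-congˡ (λ₀*weight≈Λ^leaves t)) (*-comm a _)))

  λ₀·φ∼Λ^n· : ∀ {n} (x : Sum n) → (λ₀ · φ x) ∼ ((Λ ^ n) · x)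
  λ₀·φ∼Λ^n· []                       = ·-cong λ₀ φ𝟘∼𝟘
  λ₀·φ∼Λ^n· ((a , (t , ≡.refl)) ∷ x) = begin
    λ₀ · φ (term a (t , ≡.refl) ⊕ x)            ≈⟨ ·-cong λ₀ (φ-⊕ (term a (t , ≡.refl)) x) ⟩
    λ₀ · (φ (term a (t , ≡.refl)) ⊕ φ x)        ≡⟨ ·-⊕ λ₀ (φ (term a (t , ≡.refl))) (φ x) ⟩
    (λ₀ · φ (term a (t , ≡.refl))) ⊕ (λ₀ · φ x) ≈⟨ ⊕-cong (λ₀·φ-term∼ a t) (λ₀·φ∼Λ^n· x) ⟩
    (Λ ^ leaves t) · ((a , (t , ≡.refl)) ∷ x)   ∎
    where open import Relation.Binary.Reasoning.Setoid (∼-setoid _)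

  ideal-⊆ : I₁ ⊆ I₂
  ideal-⊆ {n} x x∈I₁ = ∼𝟘⇒∈ (·-reflects-∼𝟘 (^-nonzero (*-nonzero λ₀≉0 μ₀≉0) n) Λ^n·x∼𝟘)
    where
    Λ^n·x∼𝟘 : ((Λ ^ n) · x) ∼ 𝟘
    Λ^n·x∼𝟘 = ∼-trans (∼-sym (λ₀·φ∼Λ^n· x)) (·-cong λ₀ (∼-trans (φ-cong (I₁.∈⇒∼𝟘 x∈I₁)) φ𝟘∼𝟘))

identity-morphism : ∀ {c ℓ p₁ p₂} (F : Field c ℓ)
  {I₁ : LinearMag.Ideal F p₁} {I₂ : LinearMag.Ideal F p₂} →
  ¬ LinearMag._∈I I₂ (LinearMag.⋆ F) → LinearMag._⊆_ F I₁ I₂ → LinearMag.Morphism F I₁ I₂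
identity-morphism F {I₁} {I₂} ⋆∉I₂ I₁⊆I₂ = record
  { φ         = λ x → x
  ; φ-cong    = λ {_} {x} {y} → I₁⊆I₂ (x ⊖ y)
  ; φ-⊕       = λ x y → difference∈I (∼-refl {x = x ⊕ y})
  ; φ-·       = λ a x → difference∈I (∼-refl {x = a · x})
  ; φ-∘       = λ x i y → difference∈I (∼-refl {x = x ∘⟨ i ⟩ y})
  ; φ-nonzero = λ ⋆~𝟘 → ⋆∉I₂ (∼𝟘⇒∈ ⟪ ⋆~𝟘 ⟫)
  }
  where
  open LinearMag F
  open Congruence F I₂

proposition2p1p2 : ∀ {c ℓ p₁ p₂ : Level} (F : Field c ℓ) → CharZero F →
    (I₁ : LinearMag.Ideal F p₁) (I₂ : LinearMag.Ideal F p₂) →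
    ¬ (LinearMag._∈I I₂ (LinearMag.⋆ F)) →
    (LinearMag._≼ᵢ_ F I₂ I₁ ⇔ LinearMag._⊆_ F I₁ I₂)
proposition2p1p2 F _ I₁ I₂ ⋆∉I₂ =
  mk⇔ (λ Φ {n} → MorphismIsScaling.ideal-⊆ F Φ {n}) (identity-morphism F ⋆∉I₂)
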